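{- Let $G$ be a connected graph on $n$ vertices with $\mathrm{col}(G)=d\geq 3$, let $M=K_1\vee G$, and let $w$ be the vertex of $M$ corresponding to $K_1$. Let $\mathcal{H}=(L,H)$ be an $m$-fold cover of $M$ with $m\geq d+3$ such that $E_H(L(u),L(v))$ is a perfect matching whenever $uv\in E(M)$, and write $L(w)=\{(w,j):j\in[m]\}$. If $L(w)$ contains $s$ vertices that are not level vertices, then $$P_{DP}(M,\mathcal{H})\geq m\,P_{DP}(G,m-1)+s\,(m-d-2)^{n-2}.$$
   Context: All graphs are finite and simple; $[m]=\{1,\dots,m\}$. $K_1\vee G$ is the join of a single vertex with $G$. The coloring number $\mathrm{col}(G)$ is the smallest integer $d$ for which there is an ordering of $V(G)$ in which each vertex has at most $d-1$ neighbors preceding it. A cover of a graph $G$ is a pair $\mathcal{H}=(L,H)$ where $H$ is a graph and $L:V(G)\to\mathcal{P}(V(H))$ satisfies: (1) the sets $L(u)$ partition $V(H)$; (2) each $H[L(u)]$ is complete; (3) if $E_H(L(u),L(v))$ is nonempty then $u=v$ or $uv\in E(G)$; (4) if $uv\in E(G)$ then $E_H(L(u),L(v))$ is a matching. Here $E_H(S,U)$ is the set of edges of $H$ with one endpoint in $S$ and one in $U$. The cover is $m$-fold if all $|L(u)|=m$. An $\mathcal{H}$-coloring is an independent set of $H$ of size $|V(G)|$; $P_{DP}(G,\mathcal{H})$ is their number and $P_{DP}(G,m)$ is the minimum of $P_{DP}(G,\mathcal{H})$ over all $m$-fold covers $\mathcal{H}$ of $G$. For $j\in[m]$ and $v\in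 V(G)$ set $H^{(j)}=H-N_H[(w,j)]$ and $L^{(j)}(v)=L(v)\setminus N_H((w,j))$; then $(L^{(j)},H^{(j)})$ is an $(m-1)$-fold cover of $G$. Edges of $H^{(j)}$ joining distinct sets $L^{(j)}(u)$, $L^{(j)}(v)$ ($u\ne v$ in $V(G)$) are cross-edges. A vertex $(w,t)\in L(w)$ is a level vertex if $H^{(t)}$ contains exactly $|E(G)|(m-1)$ cross-edges. -}

module Defs where

open import Data.Nat using (ℕ; zero; suc; _+_; _*_; _∸_; _≤_; _<ᵇ_; _≡ᵇ_)
open import Data.Fin using (Fin; zero; suc; toℕ)
open import Data.Bool using (Bool; true; false; _∧_; _∨_; not; if_then_else_)
open import Data.List using (List; []; _∷_; [_]; map; concatMap; length; filterᵇ)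
open import Data.Product using (Σ; _×_; _,_; ∃; ∃-syntax)
open import Relation.Binary.PropositionalEquality using (_≡_; _≢_)
open import Function using (_∘_)
open import Function.Definitions using (Injective)

countF : ∀ {k} → (Fin k → Bool) → ℕ
countF {zero}  f = 0
countF {suc k} f = (if f zero then 1 else 0) + countF (f ∘ suc)

allF : ∀ {k} → (Fin k → Bool) → Bool
allF {zero}  f = true
allF {suc k} f = f zero ∧ allF (f ∘ suc)

sumF : ∀ {k} → (Fin k → ℕ) → ℕ
sumF {zero}  f = 0
sumF {suc k} f = f zero + sumF (f ∘ suc)

allFuns : ∀ {A : Set} → List A → (k : ℕ) → List (Fin k → A)
allFuns xs zero    = [ (λ ()) ]
allFuns xs (suc k) =
  concatMap (λ a → map (λ g → λ { zero → a ; (suc i) → g i }) (allFuns xs k)) xs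

_<ᶠ_ : ∀ {k} → Fin k → Fin k → Bool
i <ᶠ j = toℕ i <ᵇ toℕ j

record Graph (n : ℕ) : Set where
  field
    adj   : Fin n → Fin n → Bool
    sym   : ∀ u v → adj u v ≡ adj v u
    loopless : ∀ u → adj u u ≡ false
open Graph public

numEdges : ∀ {n} → Graph n → ℕ
numEdges {n} G = sumF (λ u → countF (λ v → (u <ᶠ v) ∧ adj G u v))

Connected : ∀ {n} → Graph n → Set
Connected {n} G =
  (u v : Fin n) → ∃[ k ] Σ (Fin (suc k) → Fin n) λ p →
    (p zero ≡ u) × (p (Data.Fin.fromℕ k) ≡ v) ×
    ((i : Fin k) → adj G (p (Data.Fin.inject₁ i)) (p (suc i)) ≡ true)

HasColOrdering : ∀ {n} → Graph n → ℕ → Set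
HasColOrdering {n} G d =
  Σ (Fin n → Fin n) λ pos → Injective _≡_ _≡_ pos ×
    ((v : Fin n) → countF (λ u → adj G u v ∧ (pos u <ᶠ pos v)) ≤ d ∸ 1)

ColoringNumber : ∀ {n} → Graph n → ℕ → Set
ColoringNumber G d =
  HasColOrdering G d × ((d' : ℕ) → HasColOrdering G d' → d ≤ d')

-- the join K₁ ∨ G ; the new vertex w is zero, vertex v of G is suc v
joinK1 : ∀ {n} → Graph n → Graph (suc n)
joinK1 {n} G = record { adj = a ; sym = s ; loopless = l }
  where
  a : Fin (suc n) → Fin (suc n) → Bool
  a zero    zero    = false
  a zero    (suc v) = true
  a (suc u) zero    = true
  a (suc u) (suc v) = adj G u v
  s : ∀ u v → a u v ≡ a v u
  s zero    zero    = Relation.Binary.PropositionalEquality.refl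
  s zero    (suc v) = Relation.Binary.PropositionalEquality.refl
  s (suc u) zero    = Relation.Binary.PropositionalEquality.refl
  s (suc u) (suc v) = sym G u v
  l : ∀ u → a u u ≡ false
  l zero    = Relation.Binary.PropositionalEquality.refl
  l (suc u) = loopless G u

-- m-fold covers.  V(H) = V(G) × [m], L(u) = {(u,j) : j ∈ [m]}
-- (every m-fold cover is isomorphic to one of this form).

record Cover {n : ℕ} (G : Graph n) (m : ℕ) : Set where
  field
    edge : Fin n → Fin m → Fin n → Fin m → Bool
    edge-sym : ∀ u i v j → edge u i v j ≡ edge v j u i
    edge-loopless : ∀ u i → edge u i u i ≡ false
    fibre-complete : ∀ u i j → i ≢ j → edge u i u j ≡ true
    edge-adj : ∀ u i v j → u ≢ v → edge u i v j ≡ true → adj G u v ≡ true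
    matching : ∀ u v i j j' → adj G u v ≡ true →
               edge u i v j ≡ true → edge u i v j' ≡ true → j ≡ j'
open Cover public

VSubset : ℕ → ℕ → Set
VSubset n m = Fin n → Fin m → Bool

allVSubsets : (n m : ℕ) → List (VSubset n m)
allVSubsets n m = allFuns (allFuns (true ∷ false ∷ []) m) n

isIndependent : ∀ {n m} {G : Graph n} → Cover G m → VSubset n m → Bool
isIndependent 𝓗 S =
  allF λ u → allF λ i → allF λ v → allF λ j →
    not (S u i ∧ S v j ∧ edge 𝓗 u i v j)

size : ∀ {n m} → VSubset n m → ℕ
size S = sumF (λ u → countF (S u))

isHColoring : ∀ {n m} {G : Graph n} → Cover G m → VSubset n m → Bool
isHColoring {n} 𝓗 S = isIndependent 𝓗 S ∧ (size S ≡ᵇ n)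

PDP : ∀ {n m} {G : Graph n} → Cover G m → ℕ
PDP {n} {m} 𝓗 = length (filterᵇ (isHColoring 𝓗) (allVSubsets n m))

IsPDPmin : ∀ {n} → Graph n → ℕ → ℕ → Set
IsPDPmin G m k =
  (Σ (Cover G m) λ 𝓗 → PDP 𝓗 ≡ k) × ((𝓗 : Cover G m) → k ≤ PDP 𝓗)

-- E_H(L(u),L(v)) is a perfect matching whenever uv ∈ E(M)
-- (matching is already part of Cover; this adds that it saturates L(u))
PerfectMatchings : ∀ {n m} {G : Graph n} → Cover G m → Set
PerfectMatchings {n} {m} {G} 𝓗 =
  ∀ u v i → adj G u v ≡ true → ∃[ j ] (edge 𝓗 u i v j ≡ true)

-- (suc u , i) lies in N_H[(w,t)] ? (for G-vertices, N_H[(w,t)] = N_H((w,t)))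
removed : ∀ {n m} {G : Graph n} → Cover (joinK1 G) m → Fin m → Fin n → Fin m → Bool
removed 𝓗 t u i = edge 𝓗 zero t (suc u) i

-- number of cross-edges of H^(t) = H - N_H[(w,t)]: edges of H^(t) joining
-- L^(t)(u) and L^(t)(v) for distinct u, v ∈ V(G), each counted once (u < v)
crossEdges : ∀ {n m} {G : Graph n} → Cover (joinK1 G) m → Fin m → ℕ
crossEdges 𝓗 t =
  sumF λ u → sumF λ v → sumF λ i → countF λ j →
    (u <ᶠ v) ∧ not (removed 𝓗 t u i) ∧ not (removed 𝓗 t v j)
      ∧ edge 𝓗 (suc u) i (suc v) j

isLevel : ∀ {n m} {G : Graph n} → Cover (joinK1 G) m → Fin m → Bool
isLevel {n} {m} {G} 𝓗 t = crossEdges 𝓗 t ≡ᵇ numEdges G * (m ∸ 1)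

numNonLevel : ∀ {n m} {G : Graph n} → Cover (joinK1 G) m → ℕ
numNonLevel 𝓗 = countF (λ t → not (isLevel 𝓗 t))

-- Every count is expressed through `colourings n m E B`, the number of independent
-- transversals of a cover avoiding a banned set B, defined by colouring fibre 0 first.  Next, if uv ∈ E(G) and x ∈ L(u), y ∈ L(v) have no neighbour in each other's
-- fibre, then K + xy is again a cover and P_DP(K) = P_DP(K + xy) + #(colourings using
-- x and y) ≥ P_DP(G, m) + (m-d-1)^(n-2).  Finally, colouring w first gives
-- P_DP(M, H) = Σ_t P_DP(G, H^(t)); if (w, t) is not a level vertex, some uv ∈ E(G) has
-- non-adjacent deleted vertices in L(u) and L(v), and the vertices matched to them are
-- such x and y in H^(t).  Summing over t proves the lemma.

module Submission where

open import Defs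
open import Data.Nat using (ℕ; zero; suc; _+_; _*_; _∸_; _^_; _≤_; z≤n; s≤s; _<ᵇ_; _≡ᵇ_)
open import Data.Nat.Properties hiding (_≟_)
open import Data.Fin using (Fin; zero; suc; toℕ; punchIn; punchOut; _≟_)
open import Data.Fin.Properties using (punchIn-injective; punchInᵢ≢i; punchIn-punchOut; toℕ-injective)
  renaming (suc-injective to Fin-suc-injective)
open import Data.Bool using (Bool; true; false; _∧_; _∨_; not; if_then_else_; T)
open import Data.Bool.Properties using (∧-conicalˡ; ∧-conicalʳ; ∨-conicalˡ; ∨-conicalʳ; ¬-not; not-injective; ∧-identityʳ; ∨-identityʳ; ∧-zeroʳ; ∧-comm; ∨-comm)
open import Data.List using (List; []; _∷_; map; concatMap; length; filterᵇ; _++_)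
open import Data.Nat.ListAction using (sum)
open import Data.Product using (Σ; _×_; _,_; proj₁; proj₂)
open import Data.Sum using (_⊎_; inj₁; inj₂)
open import Data.Empty using (⊥; ⊥-elim)
open import Relation.Nullary using (yes; no)
open import Relation.Binary.PropositionalEquality
  using (_≡_; _≢_; refl; trans; cong; cong₂; subst; module ≡-Reasoning)
  renaming (sym to ≡-sym)
open import Function using (_∘_)

true≢false : true ≢ false
true≢false ()

≢true⇒false : ∀ {a} → a ≢ true → a ≡ false
≢true⇒false = ¬-not

∧-intro : ∀ {a b} → a ≡ true → b ≡ true → a ∧ b ≡ true
∧-intro refl refl = refl

∨-introˡ : ∀ {a} b → a ≡ true → a ∨ b ≡ true
∨-introˡ b refl = refl

∨-introʳ : ∀ a {b} → b ≡ true → a ∨ b ≡ true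
∨-introʳ true  _ = refl
∨-introʳ false p = p

∨-elim : ∀ {a b} → a ∨ b ≡ true → a ≡ true ⊎ b ≡ true
∨-elim {true}  _ = inj₁ refl
∨-elim {false} p = inj₂ p

∨-false : ∀ {a b} → a ≡ false → b ≡ false → a ∨ b ≡ false
∨-false refl refl = refl

∧-false : ∀ {a b} → a ≡ false ⊎ b ≡ false → a ∧ b ≡ false
∧-false {a} (inj₁ refl) = refl
∧-false {a} (inj₂ refl) = ∧-zeroʳ a

not-false : ∀ {a} → not a ≡ true → a ≡ false
not-false {false} _ = refl

not-true : ∀ {a} → a ≡ false → not a ≡ true
not-true refl = refl

bool-ext : ∀ {a b} → (a ≡ true → b ≡ true) → (b ≡ true → a ≡ true) → a ≡ b
bool-ext {true}  {true}  f g = refl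
bool-ext {true}  {false} f g = ≡-sym (f refl)
bool-ext {false} {true}  f g = g refl
bool-ext {false} {false} f g = refl

T⇒≡true : ∀ {b} → T b → b ≡ true
T⇒≡true {true} _ = refl

≡ᵇ⇒≡′ : ∀ {a b} → (a ≡ᵇ b) ≡ true → a ≡ b
≡ᵇ⇒≡′ {a} {b} h = ≡ᵇ⇒≡ a b (subst T (≡-sym h) _)

≡⇒≡ᵇ′ : ∀ {a b} → a ≡ b → (a ≡ᵇ b) ≡ true
≡⇒≡ᵇ′ {a} {b} h = T⇒≡true (≡⇒≡ᵇ a b h)

𝟙 : Bool → ℕ
𝟙 b = if b then 1 else 0

𝟙≤1 : ∀ b → 𝟙 b ≤ 1
𝟙≤1 true  = s≤s z≤n
𝟙≤1 false = z≤n

_==_ : ∀ {k} → Fin k → Fin k → Bool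
a == b = toℕ a ≡ᵇ toℕ b

==⇒≡ : ∀ {k} {a b : Fin k} → (a == b) ≡ true → a ≡ b
==⇒≡ h = toℕ-injective (≡ᵇ⇒≡′ h)

==-refl : ∀ {k} (a : Fin k) → (a == a) ≡ true
==-refl a = ≡⇒≡ᵇ′ {toℕ a} refl

≢⇒==false : ∀ {k} {a b : Fin k} → a ≢ b → (a == b) ≡ false
≢⇒==false ne = ≢true⇒false (λ e → ne (==⇒≡ e))

sumF-cong : ∀ {k} {f g : Fin k → ℕ} → (∀ i → f i ≡ g i) → sumF f ≡ sumF g
sumF-cong {zero}  h = refl
sumF-cong {suc k} h = cong₂ _+_ (h zero) (sumF-cong (h ∘ suc))

sumF-mono : ∀ {k} {f g : Fin k → ℕ} → (∀ i → f i ≤ g i) → sumF f ≤ sumF g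
sumF-mono {zero}  h = z≤n
sumF-mono {suc k} h = +-mono-≤ (h zero) (sumF-mono (h ∘ suc))

sumF-+ : ∀ {k} (f g : Fin k → ℕ) → sumF (λ i → f i + g i) ≡ sumF f + sumF g
sumF-+ {zero}  f g = refl
sumF-+ {suc k} f g = begin
  f zero + g zero + sumF (λ i → f (suc i) + g (suc i))
    ≡⟨ cong (f zero + g zero +_) (sumF-+ (f ∘ suc) (g ∘ suc)) ⟩
  f zero + g zero + (sumF (f ∘ suc) + sumF (g ∘ suc))
    ≡⟨ +-assoc (f zero) (g zero) _ ⟩
  f zero + (g zero + (sumF (f ∘ suc) + sumF (g ∘ suc)))
    ≡⟨ cong (f zero +_) (x+[y+z]≡y+[x+z] (g zero) (sumF (f ∘ suc)) (sumF (g ∘ suc))) ⟩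
  f zero + (sumF (f ∘ suc) + (g zero + sumF (g ∘ suc)))
    ≡⟨ ≡-sym (+-assoc (f zero) _ _) ⟩
  sumF f + sumF g ∎
  where
  open ≡-Reasoning
  x+[y+z]≡y+[x+z] : ∀ x y z → x + (y + z) ≡ y + (x + z)
  x+[y+z]≡y+[x+z] x y z = trans (≡-sym (+-assoc x y z)) (trans (cong (_+ z) (+-comm x y)) (+-assoc y x z))

sumF-const : ∀ k c → sumF {k} (λ _ → c) ≡ k * c
sumF-const zero    c = refl
sumF-const (suc k) c = cong (c +_) (sumF-const k c)

sumF-zero : ∀ k → sumF {k} (λ _ → 0) ≡ 0
sumF-zero k = trans (sumF-const k 0) (*-zeroʳ k)

sumF-*ʳ : ∀ {k} (f : Fin k → ℕ) c → sumF f * c ≡ sumF (λ i → f i * c)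
sumF-*ʳ {zero}  f c = refl
sumF-*ʳ {suc k} f c =
  trans (*-distribʳ-+ c (f zero) (sumF (f ∘ suc))) (cong (f zero * c +_) (sumF-*ʳ (f ∘ suc) c))

sumF-swap : ∀ {k l} (f : Fin k → Fin l → ℕ) →
  sumF (λ a → sumF (f a)) ≡ sumF (λ i → sumF (λ a → f a i))
sumF-swap {zero}  {l} f = ≡-sym (sumF-zero l)
sumF-swap {suc k} {l} f =
  trans (cong (sumF (f zero) +_) (sumF-swap (f ∘ suc)))
        (≡-sym (sumF-+ (f zero) (λ i → sumF (λ a → f (suc a) i))))

sumF-if : ∀ {k} b (f : Fin k → ℕ) → (if b then 0 else sumF f) ≡ sumF (λ i → if b then 0 else f i)
sumF-if {k} true  f = ≡-sym (sumF-zero k)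
sumF-if     false f = refl

sumF-punch : ∀ {k} (f : Fin (suc k) → ℕ) z → sumF f ≡ f z + sumF (f ∘ punchIn z)
sumF-punch         f zero    = refl
sumF-punch {suc k} f (suc z) = begin
  f zero + sumF (f ∘ suc)                ≡⟨ cong (f zero +_) (sumF-punch (f ∘ suc) z) ⟩
  f zero + (f (suc z) + R)               ≡⟨ ≡-sym (+-assoc (f zero) (f (suc z)) R) ⟩
  f zero + f (suc z) + R                 ≡⟨ cong (_+ R) (+-comm (f zero) (f (suc z))) ⟩
  f (suc z) + f zero + R                 ≡⟨ +-assoc (f (suc z)) (f zero) R ⟩
  f (suc z) + sumF (f ∘ punchIn (suc z)) ∎
  where
  open ≡-Reasoning
  R = sumF (λ x → f (suc (punchIn z x)))

sumF-exchange : ∀ {k} (f g : Fin k → ℕ) x → (∀ i → i ≢ x → f i ≡ g i) → sumF f + g x ≡ sumF g + f x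
sumF-exchange {suc k} f g x h = begin
  sumF f + g x                  ≡⟨ cong (_+ g x) (sumF-punch f x) ⟩
  f x + sumF (f ∘ punchIn x) + g x ≡⟨ cong (λ s → f x + s + g x) (sumF-cong (λ i → h _ (punchInᵢ≢i x i))) ⟩
  f x + S + g x                 ≡⟨ +-assoc (f x) S (g x) ⟩
  f x + (S + g x)               ≡⟨ +-comm (f x) _ ⟩
  S + g x + f x                 ≡⟨ cong (_+ f x) (+-comm S (g x)) ⟩
  g x + S + f x                 ≡⟨ cong (_+ f x) (≡-sym (sumF-punch g x)) ⟩
  sumF g + f x                  ∎
  where
  open ≡-Reasoning
  S = sumF (g ∘ punchIn x)

countF-sum : ∀ {k} (f : Fin k → Bool) → countF f ≡ sumF (λ i → 𝟙 (f i))
countF-sum {zero}  f = refl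
countF-sum {suc k} f = cong (𝟙 (f zero) +_) (countF-sum (f ∘ suc))

countF-cong : ∀ {k} {f g : Fin k → Bool} → (∀ i → f i ≡ g i) → countF f ≡ countF g
countF-cong {f = f} {g} h =
  trans (countF-sum f) (trans (sumF-cong (λ i → cong 𝟙 (h i))) (≡-sym (countF-sum g)))

countF-punch : ∀ {k} (f : Fin (suc k) → Bool) z → countF f ≡ 𝟙 (f z) + countF (f ∘ punchIn z)
countF-punch f z =
  trans (countF-sum f) (trans (sumF-punch (λ i → 𝟙 (f i)) z)
        (cong (𝟙 (f z) +_) (≡-sym (countF-sum (f ∘ punchIn z)))))

countF-punch-≤ : ∀ {k} (f : Fin (suc k) → Bool) z → countF (f ∘ punchIn z) ≤ countF f
countF-punch-≤ f z = ≤-trans (m≤n+m _ (𝟙 (f z))) (≤-reflexive (≡-sym (countF-punch f z)))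

countF-false : ∀ {k} (f : Fin k → Bool) → (∀ i → f i ≡ false) → countF f ≡ 0
countF-false {zero}  f h = refl
countF-false {suc k} f h rewrite h zero = countF-false (f ∘ suc) (h ∘ suc)

countF-∨ : ∀ {k} (f g : Fin k → Bool) → countF (λ i → f i ∨ g i) ≤ countF f + countF g
countF-∨ {zero}  f g = z≤n
countF-∨ {suc k} f g with f zero | g zero
... | true  | true  = s≤s (≤-trans (countF-∨ (f ∘ suc) (g ∘ suc)) (+-monoʳ-≤ (countF (f ∘ suc)) (n≤1+n _)))
... | true  | false = s≤s (countF-∨ (f ∘ suc) (g ∘ suc))
... | false | true  = ≤-trans (s≤s (countF-∨ (f ∘ suc) (g ∘ suc))) (≤-reflexive (≡-sym (+-suc _ _)))
... | false | false = countF-∨ (f ∘ suc) (g ∘ suc)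

countF-not : ∀ {k} (f : Fin k → Bool) → countF (λ i → not (f i)) + countF f ≡ k
countF-not {zero}  f = refl
countF-not {suc k} f with f zero
... | true  = trans (+-suc _ _) (cong suc (countF-not (f ∘ suc)))
... | false = cong suc (countF-not (f ∘ suc))

countF-atMostOne : ∀ {k} (f : Fin k → Bool) → (∀ i j → f i ≡ true → f j ≡ true → i ≡ j) → countF f ≤ 1
countF-atMostOne {zero}  f h = z≤n
countF-atMostOne {suc k} f h with f zero in eq
... | true  = ≤-reflexive (cong suc (countF-false (f ∘ suc)
                (λ i → ≢true⇒false (λ fi → zero≢suc (h zero (suc i) eq fi)))))
  where zero≢suc : ∀ {k} {i : Fin k} → Fin.zero ≢ suc i
        zero≢suc ()
... | false = countF-atMostOne (f ∘ suc) (λ i j a b → Fin-suc-injective (h (suc i) (suc j) a b))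

countF-unique : ∀ {k} (f : Fin k → Bool) i₀ → f i₀ ≡ true → (∀ i → f i ≡ true → i ≡ i₀) → countF f ≡ 1
countF-unique {suc k} f i₀ t₀ u₀ =
  trans (countF-punch f i₀) (cong₂ _+_ (cong 𝟙 t₀)
        (countF-false _ (λ i → ≢true⇒false (λ e → punchInᵢ≢i i₀ i (u₀ _ e)))))

sumF-ifconst : ∀ {k} (b : Fin k → Bool) c → sumF (λ i → if b i then 0 else c) ≡ countF (λ i → not (b i)) * c
sumF-ifconst {zero}  b c = refl
sumF-ifconst {suc k} b c with b zero
... | true  = sumF-ifconst (b ∘ suc) c
... | false = cong (c +_) (sumF-ifconst (b ∘ suc) c)

prodF : ∀ {k} → (Fin k → ℕ) → ℕ
prodF {zero}  f = 1
prodF {suc k} f = f zero * prodF (f ∘ suc)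

prodF-punch : ∀ {k} (f : Fin (suc k) → ℕ) z → prodF f ≡ f z * prodF (f ∘ punchIn z)
prodF-punch         f zero    = refl
prodF-punch {suc k} f (suc z) = begin
  f zero * prodF (f ∘ suc)    ≡⟨ cong (f zero *_) (prodF-punch (f ∘ suc) z) ⟩
  f zero * (f (suc z) * R)    ≡⟨ ≡-sym (*-assoc (f zero) (f (suc z)) R) ⟩
  f zero * f (suc z) * R      ≡⟨ cong (_* R) (*-comm (f zero) (f (suc z))) ⟩
  f (suc z) * f zero * R      ≡⟨ *-assoc (f (suc z)) (f zero) R ⟩
  f (suc z) * prodF (f ∘ punchIn (suc z)) ∎
  where
  open ≡-Reasoning
  R = prodF (λ x → f (suc (punchIn z x)))

prodF-const : ∀ k c → prodF {k} (λ _ → c) ≡ c ^ k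
prodF-const zero    c = refl
prodF-const (suc k) c = cong (c *_) (prodF-const k c)

argmin : ∀ {k} (p : Fin (suc k) → ℕ) → Σ (Fin (suc k)) λ z → ∀ u → p z ≤ p u
argmin {zero}  p = zero , λ { zero → ≤-refl }
argmin {suc k} p with argmin (p ∘ suc)
... | z , hz with p zero ≤? p (suc z)
...   | yes le = zero , λ { zero → ≤-refl ; (suc u) → ≤-trans le (hz u) }
...   | no  gt = suc z , λ { zero → <⇒≤ (≰⇒> gt) ; (suc u) → hz u }

search : ∀ {k} (f : Fin k → Bool) → (Σ (Fin k) λ i → f i ≡ true) ⊎ (∀ i → f i ≡ false)
search {zero}  f = inj₂ (λ ())
search {suc k} f with f zero in f₀ | search (f ∘ suc)
... | true  | _            = inj₁ (zero , f₀)
... | false | inj₁ (i , e) = inj₁ (suc i , e)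
... | false | inj₂ h       = inj₂ (λ { zero → f₀ ; (suc i) → h i })

search₂ : ∀ {k l} (f : Fin k → Fin l → Bool) →
  (Σ (Fin k) λ i → Σ (Fin l) λ j → f i j ≡ true) ⊎ (∀ i j → f i j ≡ false)
search₂ {zero}  f = inj₂ (λ ())
search₂ {suc k} f with search (f zero) | search₂ (f ∘ suc)
... | inj₁ (j , e) | _                = inj₁ (zero , j , e)
... | inj₂ _       | inj₁ (i , j , e) = inj₁ (suc i , j , e)
... | inj₂ h₀      | inj₂ h           = inj₂ (λ { zero j → h₀ j ; (suc i) j → h i j })

-- The edge relation of H for a cover of a graph on Fin n by Fin m, with
-- L(u) = {u} × Fin m; a subset of V(H) is a VSubset n m.
CoverEdges : ℕ → ℕ → Set
CoverEdges n m = Fin n → Fin m → Fin n → Fin m → Bool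

Symmetric : ∀ {n m} → CoverEdges n m → Set
Symmetric E = ∀ u a v b → E u a v b ≡ E v b u a

Loopless : ∀ {n m} → CoverEdges n m → Set
Loopless E = ∀ u i → E u i u i ≡ false

CompleteFibres : ∀ {n m} → CoverEdges n m → Set
CompleteFibres E = ∀ u i j → i ≢ j → E u i u j ≡ true

deleteFibre : ∀ {n m} → CoverEdges (suc n) m → Fin (suc n) → CoverEdges n m
deleteFibre E z u a v b = E (punchIn z u) a (punchIn z v) b

banNeighbours : ∀ {n m} → CoverEdges (suc n) m → VSubset (suc n) m → Fin (suc n) → Fin m →
  VSubset n m
banNeighbours E B z i u a = B (punchIn z u) a ∨ E z i (punchIn z u) a

-- colourings n m E B: the number of independent transversals of H avoiding B,
-- computed by choosing the vertex in L(0) first.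
colourings : ∀ n m → CoverEdges n m → VSubset n m → ℕ
colourings zero    m E B = 1
colourings (suc n) m E B =
  sumF λ i → if B zero i then 0 else colourings n m (deleteFibre E zero) (banNeighbours E B zero i)

colourings-cong : ∀ n m {E E' : CoverEdges n m} {B B'} →
  (∀ u a v b → u ≢ v → E u a v b ≡ E' u a v b) → (∀ u a → B u a ≡ B' u a) →
  colourings n m E B ≡ colourings n m E' B'
colourings-cong zero    m hE hB = refl
colourings-cong (suc n) m {E} {E'} {B} {B'} hE hB = sumF-cong λ i →
  cong₂ (λ b c → if b then 0 else c) (hB zero i)
    (colourings-cong n m
      (λ u a v b u≢v → hE (suc u) a (suc v) b (λ eq → u≢v (Fin-suc-injective eq)))
      (λ u a → cong₂ _∨_ (hB (suc u) a) (hE zero i (suc u) a (λ ()))))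

colourings-expand : ∀ n m (E : CoverEdges (suc n) m) B → Symmetric E → (z : Fin (suc n)) →
  colourings (suc n) m E B
    ≡ sumF (λ i → if B z i then 0 else colourings n m (deleteFibre E z) (banNeighbours E B z i))
colourings-expand n       m E B sE zero    = refl
colourings-expand (suc n) m E B sE (suc z) = begin
  sumF (λ a → if B zero a then 0 else colourings (suc n) m E₀ (B₀ a))
    ≡⟨ sumF-cong (λ a → cong (λ x → if B zero a then 0 else x)
                   (colourings-expand n m E₀ (B₀ a) (λ _ _ _ _ → sE _ _ _ _) z)) ⟩
  sumF (λ a → if B zero a then 0 else sumF (λ i → if B₀ a z i then 0 else X a i))
    ≡⟨ sumF-cong (λ a → sumF-if (B zero a) (λ i → if B₀ a z i then 0 else X a i)) ⟩
  sumF (λ a → sumF (λ i → if B zero a then 0 else if B₀ a z i then 0 else X a i))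
    ≡⟨ sumF-swap (λ a i → if B zero a then 0 else if B₀ a z i then 0 else X a i) ⟩
  sumF (λ i → sumF (λ a → if B zero a then 0 else if B₀ a z i then 0 else X a i))
    ≡⟨ sumF-cong (λ i → sumF-cong (λ a → swapGuards i a)) ⟩
  sumF (λ i → sumF (λ a → if B (suc z) i then 0 else if B zero a ∨ E (suc z) i zero a then 0 else Y i a))
    ≡⟨ sumF-cong (λ i → ≡-sym (sumF-if (B (suc z) i) (λ a → if B zero a ∨ E (suc z) i zero a then 0 else Y i a))) ⟩
  sumF (λ i → if B (suc z) i then 0 else colourings (suc n) m (deleteFibre E (suc z)) (banNeighbours E B (suc z) i)) ∎
  where
  open ≡-Reasoning
  E₀ = deleteFibre E zero
  B₀ = banNeighbours E B zero
  X = λ a i → colourings n m (deleteFibre E₀ z) (banNeighbours E₀ (B₀ a) z i)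
  Y = λ i a → colourings n m (deleteFibre (deleteFibre E (suc z)) zero)
                (banNeighbours (deleteFibre E (suc z)) (banNeighbours E B (suc z) i) zero a)
  ifs : ∀ (p q r s : Bool) (x : ℕ) → (p ∨ q) ≡ (p ∨ s) →
    (if r then 0 else if p ∨ q then 0 else x) ≡ (if p then 0 else if r ∨ s then 0 else x)
  ifs true  q true  s x e = refl
  ifs false q true  s x e = refl
  ifs true  q false s x e = refl
  ifs false q false s x e rewrite e = refl
  ∨-swap : ∀ p q r → (p ∨ q) ∨ r ≡ (p ∨ r) ∨ q
  ∨-swap true  q     r     = refl
  ∨-swap false true  true  = refl
  ∨-swap false true  false = refl
  ∨-swap false false true  = refl
  ∨-swap false false false = refl
  swapGuards : ∀ i a →
    (if B zero a then 0 else if B₀ a z i then 0 else X a i)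
      ≡ (if B (suc z) i then 0 else if B zero a ∨ E (suc z) i zero a then 0 else Y i a)
  swapGuards i a =
    trans (ifs (B (suc z) i) (E zero a (suc z) i) (B zero a) (E (suc z) i zero a) (X a i)
            (cong (B (suc z) i ∨_) (sE zero a (suc z) i)))
          (cong (λ x → if B (suc z) i then 0 else if B zero a ∨ E (suc z) i zero a then 0 else x)
            (colourings-cong n m (λ _ _ _ _ _ → refl) (λ u b → ∨-swap (B (suc (punchIn z u)) b) _ _)))

colourings-deleteBanned : ∀ n m (E : CoverEdges n (suc m)) B (r : Fin n → Fin (suc m)) →
  (∀ u → B u (r u) ≡ true) →
  colourings n (suc m) E B
    ≡ colourings n m (λ u i v j → E u (punchIn (r u) i) v (punchIn (r v) j)) (λ u i → B u (punchIn (r u) i))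
colourings-deleteBanned zero    m E B r h = refl
colourings-deleteBanned (suc n) m E B r h =
  trans (sumF-punch term (r zero))
    (trans (cong (_+ sumF (term ∘ punchIn (r zero))) bannedTerm)
      (sumF-cong (λ i → cong (λ x → if B zero (punchIn (r zero) i) then 0 else x)
        (colourings-deleteBanned n m (deleteFibre E zero) (banNeighbours E B zero (punchIn (r zero) i))
           (r ∘ suc) (λ u → ∨-introˡ _ (h (suc u)))))))
  where
  term = λ i → if B zero i then 0 else colourings n (suc m) (deleteFibre E zero) (banNeighbours E B zero i)
  bannedTerm : term (r zero) ≡ 0
  bannedTerm rewrite h zero = refl

-- If some injective ordering pos gives every fibre v at most D v banned colours
-- plus earlier A-neighbours, there are at least ∏ (m ∸ D v) colourings: colour
-- the earliest fibre z first with one of its ≥ m ∸ D z admissible colours; this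
-- bans at most one colour on each later neighbour, which is paid for by z
-- leaving the set of earlier neighbours.
colourings-greedy : ∀ n m (E : CoverEdges n m) B (A : Fin n → Fin n → Bool) (pos : Fin n → ℕ) (D : Fin n → ℕ) →
  Symmetric E →
  (∀ u v → u ≢ v → ∀ i → countF (E u i v) ≤ 𝟙 (A u v)) →
  (∀ u v → pos u ≡ pos v → u ≡ v) →
  (∀ v → countF (B v) + countF (λ u → A u v ∧ (pos u <ᵇ pos v)) ≤ D v) →
  prodF (λ u → m ∸ D u) ≤ colourings n m E B
colourings-greedy zero    m E B A pos D sE hE inj budget = ≤-refl
colourings-greedy (suc n) m E B A pos D sE hE inj budget = begin
  prodF (λ u → m ∸ D u)            ≡⟨ prodF-punch (λ u → m ∸ D u) z ⟩
  (m ∸ D z) * P                     ≤⟨ *-monoˡ-≤ P admissible ⟩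
  countF (λ i → not (B z i)) * P    ≡⟨ ≡-sym (sumF-ifconst (B z) P) ⟩
  sumF (λ i → if B z i then 0 else P)
    ≤⟨ sumF-mono recurse ⟩
  sumF (λ i → if B z i then 0 else colourings n m (deleteFibre E z) (banNeighbours E B z i))
    ≡⟨ ≡-sym (colourings-expand n m E B sE z) ⟩
  colourings (suc n) m E B ∎
  where
  open ≤-Reasoning
  z = proj₁ (argmin pos)
  P = prodF (λ w → m ∸ D (punchIn z w))

  admissible : m ∸ D z ≤ countF (λ i → not (B z i))
  admissible = begin
    m ∸ D z       ≤⟨ ∸-monoʳ-≤ m (≤-trans (m≤m+n (countF (B z)) _) (budget z)) ⟩
    m ∸ countF (B z) ≡⟨ cong (_∸ countF (B z)) (≡-sym (countF-not (B z))) ⟩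
    countF (λ i → not (B z i)) + countF (B z) ∸ countF (B z) ≡⟨ m+n∸n≡m _ (countF (B z)) ⟩
    countF (λ i → not (B z i)) ∎

  z-first : ∀ w → (pos z <ᵇ pos (punchIn z w)) ≡ true
  z-first w = T⇒≡true (<⇒<ᵇ (≤∧≢⇒< (proj₂ (argmin pos) (punchIn z w))
                                     (λ e → punchInᵢ≢i z w (≡-sym (inj _ _ e)))))

  budget′ : ∀ i w →
    countF (banNeighbours E B z i w)
      + countF (λ u → A (punchIn z u) (punchIn z w) ∧ (pos (punchIn z u) <ᵇ pos (punchIn z w)))
    ≤ D (punchIn z w)
  budget′ i w = begin
    countF (banNeighbours E B z i w) + later
      ≤⟨ +-monoˡ-≤ later (countF-∨ (B v) (E z i v)) ⟩
    countF (B v) + countF (E z i v) + later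
      ≤⟨ +-monoˡ-≤ later (+-monoʳ-≤ (countF (B v)) (hE z v (λ e → punchInᵢ≢i z w (≡-sym e)) i)) ⟩
    countF (B v) + 𝟙 (A z v) + later
      ≡⟨ +-assoc (countF (B v)) (𝟙 (A z v)) later ⟩
    countF (B v) + (𝟙 (A z v) + later)
      ≡⟨ cong (λ b → countF (B v) + (𝟙 b + later)) (≡-sym (trans (cong (A z v ∧_) (z-first w)) (∧-identityʳ (A z v)))) ⟩
    countF (B v) + (𝟙 (A z v ∧ (pos z <ᵇ pos v)) + later)
      ≡⟨ cong (countF (B v) +_) (≡-sym (countF-punch (λ u → A u v ∧ (pos u <ᵇ pos v)) z)) ⟩
    countF (B v) + countF (λ u → A u v ∧ (pos u <ᵇ pos v))
      ≤⟨ budget v ⟩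
    D v ∎
    where
    v = punchIn z w
    later = countF (λ u → A (punchIn z u) v ∧ (pos (punchIn z u) <ᵇ pos v))

  recurse : ∀ i → (if B z i then 0 else P)
                ≤ (if B z i then 0 else colourings n m (deleteFibre E z) (banNeighbours E B z i))
  recurse i with B z i
  ... | true  = ≤-refl
  ... | false = colourings-greedy n m (deleteFibre E z) (banNeighbours E B z i)
        (λ u v → A (punchIn z u) (punchIn z v)) (pos ∘ punchIn z) (D ∘ punchIn z)
        (λ _ _ _ _ → sE _ _ _ _)
        (λ u v u≢v → hE _ _ (λ e → u≢v (punchIn-injective z u v e)))
        (λ u v e → punchIn-injective z u v (inj _ _ e))
        (budget′ i)

#filter : ∀ {A : Set} → (A → Bool) → List A → ℕ
#filter P xs = length (filterᵇ P xs)

#filter-∷ : ∀ {A : Set} (P : A → Bool) x xs → #filter P (x ∷ xs) ≡ 𝟙 (P x) + #filter P xs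
#filter-∷ P x xs with P x
... | true  = refl
... | false = refl

#filter-++ : ∀ {A : Set} (P : A → Bool) xs ys → #filter P (xs ++ ys) ≡ #filter P xs + #filter P ys
#filter-++ P []       ys = refl
#filter-++ P (x ∷ xs) ys =
  trans (#filter-∷ P x (xs ++ ys)) (trans (cong (𝟙 (P x) +_) (#filter-++ P xs ys))
    (trans (≡-sym (+-assoc (𝟙 (P x)) _ _)) (cong (_+ #filter P ys) (≡-sym (#filter-∷ P x xs)))))

#filter-map : ∀ {A B : Set} (P : B → Bool) (f : A → B) xs → #filter P (map f xs) ≡ #filter (P ∘ f) xs
#filter-map P f []       = refl
#filter-map P f (x ∷ xs) =
  trans (#filter-∷ P (f x) (map f xs))
    (trans (cong (𝟙 (P (f x)) +_) (#filter-map P f xs)) (≡-sym (#filter-∷ (P ∘ f) x xs)))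

#filter-concatMap : ∀ {A B : Set} (P : B → Bool) (h : A → List B) xs →
  #filter P (concatMap h xs) ≡ sum (map (λ a → #filter P (h a)) xs)
#filter-concatMap P h []       = refl
#filter-concatMap P h (x ∷ xs) =
  trans (#filter-++ P (h x) (concatMap h xs)) (cong (#filter P (h x) +_) (#filter-concatMap P h xs))

#filter-cong : ∀ {A : Set} {P Q : A → Bool} xs → (∀ x → P x ≡ Q x) → #filter P xs ≡ #filter Q xs
#filter-cong []       h = refl
#filter-cong {P = P} {Q} (x ∷ xs) h =
  trans (#filter-∷ P x xs) (trans (cong₂ _+_ (cong 𝟙 (h x)) (#filter-cong xs h)) (≡-sym (#filter-∷ Q x xs)))

#filter-none : ∀ {A : Set} (P : A → Bool) xs → (∀ x → P x ≡ false) → #filter P xs ≡ 0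
#filter-none P xs h = trans (#filter-cong xs h) (none xs)
  where none : ∀ ys → #filter (λ _ → false) ys ≡ 0
        none []       = refl
        none (y ∷ ys) = none ys

#filter-guard : ∀ {A : Set} b (P : A → Bool) xs → #filter (λ x → not b ∧ P x) xs ≡ (if b then 0 else #filter P xs)
#filter-guard true  P xs = #filter-none _ xs (λ _ → refl)
#filter-guard false P xs = refl

sum-map-cong : ∀ {A : Set} {f g : A → ℕ} xs → (∀ x → f x ≡ g x) → sum (map f xs) ≡ sum (map g xs)
sum-map-cong []       h = refl
sum-map-cong (x ∷ xs) h = cong₂ _+_ (h x) (sum-map-cong xs h)

sum-map-++ : ∀ {A : Set} (f : A → ℕ) xs ys → sum (map f (xs ++ ys)) ≡ sum (map f xs) + sum (map f ys)
sum-map-++ f []       ys = refl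
sum-map-++ f (x ∷ xs) ys = trans (cong (f x +_) (sum-map-++ f xs ys)) (≡-sym (+-assoc (f x) _ _))

sum-map-map : ∀ {A B : Set} (f : B → ℕ) (g : A → B) xs → sum (map f (map g xs)) ≡ sum (map (f ∘ g) xs)
sum-map-map f g []       = refl
sum-map-map f g (x ∷ xs) = cong (f (g x) +_) (sum-map-map f g xs)

sum-map-zero : ∀ {A : Set} (f : A → ℕ) xs → (∀ x → f x ≡ 0) → sum (map f xs) ≡ 0
sum-map-zero f []       h = refl
sum-map-zero f (x ∷ xs) h rewrite h x = sum-map-zero f xs h

bools : List Bool
bools = true ∷ false ∷ []

sum-rows-empty : ∀ m (F : (Fin m → Bool) → ℕ) c → (∀ a → countF a ≢ 0 → F a ≡ 0) →
  (∀ a → (∀ i → a i ≡ false) → F a ≡ c) → sum (map F (allFuns bools m)) ≡ c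
sum-rows-empty zero    F c h₀ hc = trans (+-identityʳ _) (hc _ (λ ()))
sum-rows-empty (suc m) F c h₀ hc =
  trans (sum-map-++ F (map _ rows) _) (cong₂ _+_
    (trans (sum-map-map F _ rows) (sum-map-zero _ rows (λ a → h₀ _ (λ ()))))
    (trans (sum-map-++ F (map _ rows) []) (trans (+-identityʳ _) (trans (sum-map-map F _ rows)
       (sum-rows-empty m _ c (λ a ne → h₀ _ ne) (λ a ha → hc _ (λ { zero → refl ; (suc i) → ha i })))))))
  where rows = allFuns bools m

sum-rows-singletons : ∀ m (F : (Fin m → Bool) → ℕ) (g : Fin m → ℕ) → (∀ a → countF a ≢ 1 → F a ≡ 0) →
  (∀ a i₀ → a i₀ ≡ true → (∀ i → a i ≡ true → i ≡ i₀) → F a ≡ g i₀) →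
  sum (map F (allFuns bools m)) ≡ sumF g
sum-rows-singletons zero    F g h₀ hc = trans (+-identityʳ _) (h₀ _ (λ ()))
sum-rows-singletons (suc m) F g h₀ hc =
  trans (sum-map-++ F (map _ rows) _) (cong₂ _+_
    (trans (sum-map-map F _ rows)
      (sum-rows-empty m _ (g zero) (λ a ne → h₀ _ (λ e → ne (suc-injective e)))
        (λ a ha → hc _ zero refl (λ { zero _ → refl ; (suc i) e → ⊥-elim (true≢false (trans (≡-sym e) (ha i))) }))))
    (trans (sum-map-++ F (map _ rows) []) (trans (+-identityʳ _) (trans (sum-map-map F _ rows)
      (sum-rows-singletons m _ (g ∘ suc) (λ a ne → h₀ _ ne)
        (λ a i₀ ai hi → hc _ (suc i₀) ai (λ { zero () ; (suc i) e → cong suc (hi i e) })))))))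
  where rows = allFuns bools m

allF⇒ : ∀ {k} {f : Fin k → Bool} → allF f ≡ true → ∀ i → f i ≡ true
allF⇒ {suc k} {f} h zero    = ∧-conicalˡ _ _ h
allF⇒ {suc k} {f} h (suc i) = allF⇒ {f = f ∘ suc} (∧-conicalʳ (f zero) _ h) i

⇒allF : ∀ {k} {f : Fin k → Bool} → (∀ i → f i ≡ true) → allF f ≡ true
⇒allF {zero}  h = refl
⇒allF {suc k} h = ∧-intro (h zero) (⇒allF (h ∘ suc))

Independent : ∀ {n m} → CoverEdges n m → VSubset n m → Set
Independent E S = ∀ u i v j → S u i ≡ true → S v j ≡ true → E u i v j ≡ false

Avoids : ∀ {n m} → VSubset n m → VSubset n m → Set
Avoids B S = ∀ u i → S u i ≡ true → B u i ≡ false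

independentᵇ : ∀ {n m} → CoverEdges n m → VSubset n m → Bool
independentᵇ E S = allF λ u → allF λ i → allF λ v → allF λ j → not (S u i ∧ S v j ∧ E u i v j)

avoidsᵇ : ∀ {n m} → VSubset n m → VSubset n m → Bool
avoidsᵇ B S = allF λ u → allF λ i → not (S u i ∧ B u i)

isColouring : ∀ n {m} → CoverEdges n m → VSubset n m → VSubset n m → Bool
isColouring n E B S = independentᵇ E S ∧ avoidsᵇ B S ∧ (size S ≡ᵇ n)

isColouring⇒ : ∀ n {m} {E : CoverEdges n m} {B S} → isColouring n E B S ≡ true →
  Independent E S × Avoids B S × size S ≡ n
isColouring⇒ n {E = E} {B} {S} h =
  (λ u i v j su sv → nand₃ (allF⇒ (allF⇒ (allF⇒ (allF⇒ (∧-conicalˡ _ _ h) u) i) v) j) su sv) ,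
  (λ u i su → nand₂ (allF⇒ (allF⇒ (∧-conicalˡ _ _ rest) u) i) su) ,
  ≡ᵇ⇒≡′ (∧-conicalʳ (avoidsᵇ B S) _ rest)
  where
  rest : avoidsᵇ B S ∧ (size S ≡ᵇ n) ≡ true
  rest = ∧-conicalʳ (independentᵇ E S) _ h
  nand₃ : ∀ {a b c} → not (a ∧ b ∧ c) ≡ true → a ≡ true → b ≡ true → c ≡ false
  nand₃ {true} {true} {false} _ _ _ = refl
  nand₂ : ∀ {a b} → not (a ∧ b) ≡ true → a ≡ true → b ≡ false
  nand₂ {true} {false} _ _ = refl

⇒isColouring : ∀ n {m} {E : CoverEdges n m} {B S} → Independent E S → Avoids B S → size S ≡ n →
  isColouring n E B S ≡ true
⇒isColouring n ind av sz =
  ∧-intro (⇒allF λ u → ⇒allF λ i → ⇒allF λ v → ⇒allF λ j → nand₃ (ind u i v j))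
          (∧-intro (⇒allF λ u → ⇒allF λ i → nand₂ (av u i)) (≡⇒≡ᵇ′ sz))
  where
  nand₃ : ∀ {a b c} → (a ≡ true → b ≡ true → c ≡ false) → not (a ∧ b ∧ c) ≡ true
  nand₃ {true}  {true}  h rewrite h refl refl = refl
  nand₃ {true}  {false} h = refl
  nand₃ {false}         h = refl
  nand₂ : ∀ {a b} → (a ≡ true → b ≡ false) → not (a ∧ b) ≡ true
  nand₂ {true}  h rewrite h refl = refl
  nand₂ {false} h = refl

isColouring-cong : ∀ n {m} {E : CoverEdges n m} {B} {S S' : VSubset n m} → (∀ u i → S u i ≡ S' u i) →
  isColouring n E B S ≡ isColouring n E B S'
isColouring-cong n {m} {E} {B} h = bool-ext (transport h) (transport (λ u i → ≡-sym (h u i)))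
  where
  transport : ∀ {X Y : VSubset n m} → (∀ u i → X u i ≡ Y u i) → isColouring n E B X ≡ true → isColouring n E B Y ≡ true
  transport e p with isColouring⇒ n {E = E} {B = B} p
  ... | ind , av , sz = ⇒isColouring n
          (λ u i v j a b → ind u i v j (trans (e u i) a) (trans (e v j) b))
          (λ u i a → av u i (trans (e u i) a))
          (trans (sumF-cong (λ u → countF-cong (λ i → ≡-sym (e u i)))) sz)

fibre-atMostOne : ∀ {n m} {E : CoverEdges n m} {S} → CompleteFibres E → Independent E S →
  ∀ u → countF (S u) ≤ 1
fibre-atMostOne {E = E} {S} fc ind u = countF-atMostOne (S u) same
  where
  same : ∀ i j → S u i ≡ true → S u j ≡ true → i ≡ j
  same i j si sj with i ≟ j
  ... | yes e  = e
  ... | no  ne = ⊥-elim (true≢false (trans (≡-sym (fc u i j ne)) (ind u i u j si sj)))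

consRow : ∀ {n m} → (Fin m → Bool) → VSubset n m → VSubset (suc n) m
consRow a S zero    = a
consRow a S (suc u) = S u

isColouring-singleton : ∀ n {m} (E : CoverEdges (suc n) m) B (T : VSubset (suc n) m) i₀ →
  Symmetric E → Loopless E → T zero i₀ ≡ true → (∀ i → T zero i ≡ true → i ≡ i₀) →
  isColouring (suc n) E B T
    ≡ (not (B zero i₀) ∧ isColouring n (deleteFibre E zero) (banNeighbours E B zero i₀) (T ∘ suc))
isColouring-singleton n {m} E B T i₀ sE lp t₀ u₀ = bool-ext forward backward
  where
  one : countF (T zero) ≡ 1
  one = countF-unique (T zero) i₀ t₀ u₀
  forward : _
  forward h with isColouring⇒ (suc n) {E = E} {B = B} {S = T} h
  ... | ind , av , sz = ∧-intro (not-true (av zero i₀ t₀))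
      (⇒isColouring n (λ u i v j → ind (suc u) i (suc v) j)
        (λ u a ta → ∨-false (av (suc u) a ta) (ind zero i₀ (suc u) a t₀ ta))
        (suc-injective (trans (cong (_+ size (T ∘ suc)) (≡-sym one)) sz)))
  backward : _
  backward h with not-false (∧-conicalˡ _ _ h) | isColouring⇒ n {S = T ∘ suc} (∧-conicalʳ (not (B zero i₀)) _ h)
  ... | b₀ | (ind , av , sz) = ⇒isColouring (suc n) ind′ av′ (trans (cong (_+ size (T ∘ suc)) one) (cong suc sz))
    where
    ind′ : Independent E T
    ind′ zero    i zero    j a b rewrite u₀ i a | u₀ j b = lp zero i₀
    ind′ zero    i (suc v) j a b rewrite u₀ i a = ∨-conicalʳ _ _ (av v j b)
    ind′ (suc u) i zero    j a b rewrite u₀ j b = trans (sE (suc u) i zero i₀) (∨-conicalʳ _ _ (av u i a))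
    ind′ (suc u) i (suc v) j a b = ind u i v j a b
    av′ : Avoids B T
    av′ zero    i a rewrite u₀ i a = b₀
    av′ (suc u) i a = ∨-conicalˡ _ _ (av u i a)

isColouring-notSingleton : ∀ n {m} (E : CoverEdges (suc n) m) B (T : VSubset (suc n) m) → CompleteFibres E →
  countF (T zero) ≢ 1 → isColouring (suc n) E B T ≡ false
isColouring-notSingleton n E B T fc ≢1 = ≢true⇒false impossible
  where
  impossible : isColouring (suc n) E B T ≡ true → ⊥
  impossible h with isColouring⇒ (suc n) {E = E} {B = B} {S = T} h
  ... | ind , av , sz = <-irrefl refl (begin-strict
      n                                <⟨ n<1+n n ⟩
      suc n                            ≡⟨ ≡-sym sz ⟩
      countF (T zero) + size (T ∘ suc) ≡⟨ cong (_+ size (T ∘ suc)) empty ⟩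
      size (T ∘ suc)                   ≤⟨ sumF-mono (fibre-atMostOne (λ u → fc (suc u)) (λ u i v j → ind (suc u) i (suc v) j)) ⟩
      sumF {n} (λ _ → 1)               ≡⟨ trans (sumF-const n 1) (*-identityʳ n) ⟩
      n                                ∎)
    where
    open ≤-Reasoning
    empty : countF (T zero) ≡ 0
    empty = ≤1∧≢1⇒0 (countF (T zero)) (fibre-atMostOne fc ind zero) ≢1
      where ≤1∧≢1⇒0 : ∀ c → c ≤ 1 → c ≢ 1 → c ≡ 0
            ≤1∧≢1⇒0 zero          _         _  = refl
            ≤1∧≢1⇒0 (suc zero)    _         ne = ⊥-elim (ne refl)
            ≤1∧≢1⇒0 (suc (suc _)) (s≤s ()) _

#colourings : ∀ n m (E : CoverEdges n m) B → Symmetric E → Loopless E → CompleteFibres E →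
  #filter (isColouring n E B) (allVSubsets n m) ≡ colourings n m E B
#colourings zero    m E B sE lp fc = refl
#colourings (suc n) m E B sE lp fc =
  trans (#filter-concatMap (isColouring (suc n) E B) _ rows)
    (trans (sum-map-cong rows (λ a → prependRow _ a (λ S → λ { zero i → refl ; (suc u) i → refl })))
      (sum-rows-singletons m _ _
        (λ a ≢1 → #filter-none _ rest (λ S → isColouring-notSingleton n E B (consRow a S) fc ≢1))
        (λ a i₀ ai ui → trans (#filter-cong rest (λ S → isColouring-singleton n E B (consRow a S) i₀ sE lp ai ui))
          (trans (#filter-guard (B zero i₀) _ rest)
            (cong (λ x → if B zero i₀ then 0 else x)
              (#colourings n m (deleteFibre E zero) (banNeighbours E B zero i₀)
                 (λ _ _ _ _ → sE _ _ _ _) (λ u → lp (suc u)) (λ u → fc (suc u))))))))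
  where
  rows = allFuns bools m
  rest = allFuns rows n
  prependRow : (f : VSubset n m → VSubset (suc n) m) (a : Fin m → Bool) → (∀ S u i → f S u i ≡ consRow a S u i) →
    #filter (isColouring (suc n) E B) (map f rest) ≡ #filter (λ S → isColouring (suc n) E B (consRow a S)) rest
  prependRow f a h = trans (#filter-map (isColouring (suc n) E B) f rest)
    (#filter-cong rest (λ S → isColouring-cong (suc n) {E = E} {B = B} {S = f S} (h S)))

PDP≡colourings : ∀ {n m} {G : Graph n} (𝓗 : Cover G m) → PDP 𝓗 ≡ colourings n m (edge 𝓗) (λ _ _ → false)
PDP≡colourings {n} {m} 𝓗 =
  trans (#filter-cong (allVSubsets n m) (λ S → cong (independentᵇ (edge 𝓗) S ∧_) (≡-sym (noBans S))))
        (#colourings n m (edge 𝓗) (λ _ _ → false) (edge-sym 𝓗) (edge-loopless 𝓗) (fibre-complete 𝓗))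
  where
  noBans : ∀ S → (avoidsᵇ (λ _ _ → false) S ∧ (size S ≡ᵇ n)) ≡ (size S ≡ᵇ n)
  noBans S rewrite ⇒allF {f = λ u → allF λ i → not (S u i ∧ false)} (λ u → ⇒allF (λ i → cong not (∧-zeroʳ (S u i)))) = refl

cover-neighbours≤ : ∀ {n m} {G : Graph n} (K : Cover G m) a b → a ≢ b → ∀ i →
  countF (edge K a i b) ≤ 𝟙 (adj G a b)
cover-neighbours≤ {G = G} K a b a≢b i with adj G a b in ab
... | true  = countF-atMostOne (edge K a i b) (λ j j' e e' → matching K a b i j j' ab e e')
... | false = ≤-reflexive (countF-false _ (λ j → ≢true⇒false (λ e →
                true≢false (trans (≡-sym (edge-adj K a i b j a≢b e)) ab))))

sumF₂-exchange : ∀ {k l} (f g : Fin k → Fin l → ℕ) x y → (∀ i j → i ≢ x ⊎ j ≢ y → f i j ≡ g i j) →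
  sumF (λ i → sumF (f i)) + g x y ≡ sumF (λ i → sumF (g i)) + f x y
sumF₂-exchange f g x y h = +-cancelʳ-≡ (G x) _ _ (begin
  ΣF + g x y + G x   ≡⟨ +-swapʳ ΣF (g x y) (G x) ⟩
  ΣF + G x + g x y   ≡⟨ cong (_+ g x y) outer ⟩
  ΣG + F x + g x y   ≡⟨ +-assoc ΣG (F x) (g x y) ⟩
  ΣG + (F x + g x y) ≡⟨ cong (ΣG +_) inner ⟩
  ΣG + (G x + f x y) ≡⟨ ≡-sym (+-assoc ΣG (G x) (f x y)) ⟩
  ΣG + G x + f x y   ≡⟨ +-swapʳ ΣG (G x) (f x y) ⟩
  ΣG + f x y + G x   ∎)
  where
  open ≡-Reasoning
  F = λ i → sumF (f i)
  G = λ i → sumF (g i)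
  ΣF = sumF F
  ΣG = sumF G
  +-swapʳ : ∀ a b c → a + b + c ≡ a + c + b
  +-swapʳ a b c = trans (+-assoc a b c) (trans (cong (a +_) (+-comm b c)) (≡-sym (+-assoc a c b)))
  outer : ΣF + G x ≡ ΣG + F x
  outer = sumF-exchange F G x (λ i i≢x → sumF-cong (λ j → h i j (inj₁ i≢x)))
  inner : F x + g x y ≡ G x + f x y
  inner = sumF-exchange (f x) (g x) y (λ j j≢y → h x j (inj₂ j≢y))

module AddEdge {n} (G : Graph n) {m} (K : Cover G m) {u v : Fin n} (u≢v : u ≢ v) (uv : adj G u v ≡ true)
  {x y : Fin m} (x-free : ∀ j → edge K u x v j ≡ false) (y-free : ∀ j → edge K v y u j ≡ false) where

  isX : Fin n → Fin m → Bool
  isX a i = (a == u) ∧ (i == x)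

  isY : Fin n → Fin m → Bool
  isY a i = (a == v) ∧ (i == y)

  isX⇒ : ∀ {a i} → isX a i ≡ true → a ≡ u × i ≡ x
  isX⇒ {a} h = ==⇒≡ (∧-conicalˡ (a == u) _ h) , ==⇒≡ (∧-conicalʳ (a == u) _ h)

  isY⇒ : ∀ {a i} → isY a i ≡ true → a ≡ v × i ≡ y
  isY⇒ {a} h = ==⇒≡ (∧-conicalˡ (a == v) _ h) , ==⇒≡ (∧-conicalʳ (a == v) _ h)

  isX-off : ∀ a i → a ≢ u ⊎ i ≢ x → isX a i ≡ false
  isX-off a i (inj₁ a≢u) = ∧-false (inj₁ (≢⇒==false a≢u))
  isX-off a i (inj₂ i≢x) = ∧-false (inj₂ (≢⇒==false i≢x))

  isY-off : ∀ a i → a ≢ v ⊎ i ≢ y → isY a i ≡ false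
  isY-off a i (inj₁ a≢v) = ∧-false (inj₁ (≢⇒==false a≢v))
  isY-off a i (inj₂ i≢y) = ∧-false (inj₂ (≢⇒==false i≢y))

  edges+xy : CoverEdges n m
  edges+xy a i b j = edge K a i b j ∨ ((isX a i ∧ isY b j) ∨ (isY a i ∧ isX b j))

  data Edge+xy (a : Fin n) (i : Fin m) (b : Fin n) (j : Fin m) : Set where
    old : edge K a i b j ≡ true → Edge+xy a i b j
    xy  : a ≡ u → i ≡ x → b ≡ v → j ≡ y → Edge+xy a i b j
    yx  : a ≡ v → i ≡ y → b ≡ u → j ≡ x → Edge+xy a i b j

  edge+xy-view : ∀ {a i b j} → edges+xy a i b j ≡ true → Edge+xy a i b j
  edge+xy-view {a} {i} {b} {j} h with ∨-elim {edge K a i b j} h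
  ... | inj₁ e = old e
  ... | inj₂ e with ∨-elim {isX a i ∧ isY b j} e
  ...   | inj₁ e₁ with isX⇒ (∧-conicalˡ _ _ e₁) | isY⇒ (∧-conicalʳ (isX a i) _ e₁)
  ...     | a≡u , i≡x | b≡v , j≡y = xy a≡u i≡x b≡v j≡y
  edge+xy-view {a} {i} {b} {j} h | inj₂ e | inj₂ e₂ with isY⇒ (∧-conicalˡ _ _ e₂) | isX⇒ (∧-conicalʳ (isY a i) _ e₂)
  ...     | a≡v , i≡y | b≡u , j≡x = yx a≡v i≡y b≡u j≡x

  edges+xy-sym : Symmetric edges+xy
  edges+xy-sym a i b j
    rewrite edge-sym K a i b j | ∧-comm (isX a i) (isY b j) | ∧-comm (isY a i) (isX b j)
    = cong (edge K b j a i ∨_) (∨-comm (isY b j ∧ isX a i) (isX b j ∧ isY a i))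

  K+xy : Cover G m
  K+xy = record
    { edge           = edges+xy
    ; edge-sym       = edges+xy-sym
    ; edge-loopless  = λ a i → ≢true⇒false (noLoop ∘ edge+xy-view)
    ; fibre-complete = λ a i j i≢j → ∨-introˡ _ (fibre-complete K a i j i≢j)
    ; edge-adj       = λ a i b j a≢b e → adjacent a≢b (edge+xy-view e)
    ; matching       = λ a b i j j' ab e e' → unique ab (edge+xy-view e) (edge+xy-view e')
    }
    where
    noLoop : ∀ {a i} → Edge+xy a i a i → ⊥
    noLoop {a} {i} (old e)   = true≢false (trans (≡-sym e) (edge-loopless K a i))
    noLoop (xy p _ q _) = u≢v (trans (≡-sym p) q)
    noLoop (yx p _ q _) = u≢v (trans (≡-sym q) p)
    adjacent : ∀ {a i b j} → a ≢ b → Edge+xy a i b j → adj G a b ≡ true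
    adjacent {a} {i} {b} {j} a≢b (old e) = edge-adj K a i b j a≢b e
    adjacent _ (xy refl _ refl _) = uv
    adjacent _ (yx refl _ refl _) = trans (Graph.sym G v u) uv
    -- x and y gain exactly one neighbour each, in the fibres where they had none
    unique : ∀ {a b i j j'} → adj G a b ≡ true → Edge+xy a i b j → Edge+xy a i b j' → j ≡ j'
    unique {a} {b} {i} {j} {j'} ab (old e) (old e') = matching K a b i j j' ab e e'
    unique {j = j} ab (old e) (xy refl refl refl refl) = ⊥-elim (true≢false (trans (≡-sym e) (x-free j)))
    unique {j = j} ab (old e) (yx refl refl refl refl) = ⊥-elim (true≢false (trans (≡-sym e) (y-free j)))
    unique {j' = j'} ab (xy refl refl refl refl) (old e') = ⊥-elim (true≢false (trans (≡-sym e') (x-free j')))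
    unique ab (xy _ _ _ q) (xy _ _ _ q') = trans q (≡-sym q')
    unique ab (xy p _ _ _) (yx p' _ _ _) = ⊥-elim (u≢v (trans (≡-sym p) p'))
    unique {j' = j'} ab (yx refl refl refl refl) (old e') = ⊥-elim (true≢false (trans (≡-sym e') (y-free j')))
    unique ab (yx p _ _ _) (xy p' _ _ _) = ⊥-elim (u≢v (trans (≡-sym p') p))
    unique ab (yx _ _ _ q) (yx _ _ _ q') = trans q (≡-sym q')

  edges+xy-xy : edges+xy u x v y ≡ true
  edges+xy-xy = ∨-introʳ (edge K u x v y)
    (∨-introˡ _ (∧-intro (∧-intro (==-refl u) (==-refl x)) (∧-intro (==-refl v) (==-refl y))))

  edges+xy-agree : ∀ a i b j → isX a i ≡ false ⊎ isY b j ≡ false → isY a i ≡ false ⊎ isX b j ≡ false →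
    edges+xy a i b j ≡ edge K a i b j
  edges+xy-agree a i b j h h' = trans (cong (edge K a i b j ∨_) (∨-false (∧-false h) (∧-false h'))) (∨-identityʳ _)

-- Counting colourings of H against those of H + xy: they differ by the colourings of
-- H that use both x and y, and there are many of those by the greedy bound.
module AddEdgeCount {n} (G : Graph (suc (suc n))) {m} (K : Cover G m) {u v : Fin (suc (suc n))}
  (u≢v : u ≢ v) (uv : adj G u v ≡ true) {x y : Fin m}
  (x-free : ∀ j → edge K u x v j ≡ false) (y-free : ∀ j → edge K v y u j ≡ false) where

  open AddEdge G K u≢v uv x-free y-free

  -- v as a fibre of the cover with L(u) deleted
  v′ : Fin (suc n)
  v′ = punchOut u≢v

  v′-is-v : punchIn u v′ ≡ v
  v′-is-v = punchIn-punchOut u≢v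

  other : Fin n → Fin (suc (suc n))
  other w = punchIn u (punchIn v′ w)

  other≢u : ∀ w → other w ≢ u
  other≢u w = punchInᵢ≢i u _

  other≢v : ∀ w → other w ≢ v
  other≢v w e = punchInᵢ≢i v′ w (punchIn-injective u _ _ (trans e (≡-sym v′-is-v)))

  other-injective : ∀ w w' → other w ≡ other w' → w ≡ w'
  other-injective w w' e = punchIn-injective v′ _ _ (punchIn-injective u _ _ e)

  noBans : VSubset (suc (suc n)) m
  noBans _ _ = false

  -- colourings with u ↦ i and v ↦ j, counted on the other fibres
  colouringsWith : CoverEdges (suc (suc n)) m → Fin m → Fin m → ℕ
  colouringsWith E i j =
    colourings n m (deleteFibre (deleteFibre E u) v′) (banNeighbours (deleteFibre E u) (banNeighbours E noBans u i) v′ j)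

  pairTerm : CoverEdges (suc (suc n)) m → Fin m → Fin m → ℕ
  pairTerm E i j = if E u i (punchIn u v′) j then 0 else colouringsWith E i j

  colourings-pairs : ∀ E → Symmetric E → colourings (suc (suc n)) m E noBans ≡ sumF (λ i → sumF (pairTerm E i))
  colourings-pairs E sE = trans (colourings-expand (suc n) m E noBans sE u)
    (sumF-cong (λ i → colourings-expand n m (deleteFibre E u) (banNeighbours E noBans u i) (λ _ _ _ _ → sE _ _ _ _) v′))

  colouringsWith-agree : ∀ i j → colouringsWith edges+xy i j ≡ colouringsWith (edge K) i j
  colouringsWith-agree i j = colourings-cong n m
    (λ w a w' b _ → edges+xy-agree (other w) a (other w') b (inj₁ (isX-off (other w) a (inj₁ (other≢u w))))
                                                           (inj₁ (isY-off (other w) a (inj₁ (other≢v w)))))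
    (λ w a → cong₂ _∨_
      (edges+xy-agree u i (other w) a (inj₂ (isY-off (other w) a (inj₁ (other≢v w)))) (inj₁ (isY-off u i (inj₁ u≢v))))
      (edges+xy-agree (punchIn u v′) j (other w) a (inj₁ (isX-off (punchIn u v′) j (inj₁ (punchInᵢ≢i u v′))))
                                                 (inj₂ (isX-off (other w) a (inj₁ (other≢u w))))))

  pairTerm-agree : ∀ i j → i ≢ x ⊎ j ≢ y → pairTerm (edge K) i j ≡ pairTerm edges+xy i j
  pairTerm-agree i j h = ≡-sym (cong₂ (λ b c → if b then 0 else c)
    (edges+xy-agree u i (punchIn u v′) j (pair h) (inj₁ (isY-off u i (inj₁ u≢v))))
    (colouringsWith-agree i j))
    where
    pair : i ≢ x ⊎ j ≢ y → isX u i ≡ false ⊎ isY (punchIn u v′) j ≡ false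
    pair (inj₁ i≢x) = inj₁ (isX-off u i (inj₂ i≢x))
    pair (inj₂ j≢y) = inj₂ (isY-off (punchIn u v′) j (inj₂ j≢y))

  pairTerm+xy-x-y : pairTerm edges+xy x y ≡ 0
  pairTerm+xy-x-y rewrite v′-is-v | edges+xy-xy = refl

  pairTerm-x-y : pairTerm (edge K) x y ≡ colouringsWith (edge K) x y
  pairTerm-x-y rewrite v′-is-v | x-free y = refl

  PDP-addEdge : PDP K ≡ PDP K+xy + colouringsWith (edge K) x y
  PDP-addEdge = begin
    PDP K
      ≡⟨ trans (PDP≡colourings K) (colourings-pairs (edge K) (edge-sym K)) ⟩
    sumF (λ i → sumF (pairTerm (edge K) i))
      ≡⟨ ≡-sym (+-identityʳ _) ⟩
    sumF (λ i → sumF (pairTerm (edge K) i)) + 0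
      ≡⟨ cong (sumF (λ i → sumF (pairTerm (edge K) i)) +_) (≡-sym pairTerm+xy-x-y) ⟩
    sumF (λ i → sumF (pairTerm (edge K) i)) + pairTerm edges+xy x y
      ≡⟨ sumF₂-exchange (pairTerm (edge K)) (pairTerm edges+xy) x y pairTerm-agree ⟩
    sumF (λ i → sumF (pairTerm edges+xy i)) + pairTerm (edge K) x y
      ≡⟨ cong₂ _+_ (≡-sym (trans (PDP≡colourings K+xy) (colourings-pairs edges+xy edges+xy-sym))) pairTerm-x-y ⟩
    PDP K+xy + colouringsWith (edge K) x y ∎
    where open ≡-Reasoning

  -- every other fibre loses at most one colour to each of x, y and at most
  -- d ∸ 1 colours to earlier neighbours in an ordering witnessing col(G) ≤ d
  colouringsWith-bound : ∀ d → HasColOrdering G d → (m ∸ (d ∸ 1 + 2)) ^ n ≤ colouringsWith (edge K) x y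
  colouringsWith-bound d (pos , pos-injective , earlier≤) =
    subst (_≤ colouringsWith (edge K) x y) (prodF-const n (m ∸ (d ∸ 1 + 2)))
      (colourings-greedy n m _ _ (λ w w' → adj G (other w) (other w'))
         (λ w → toℕ (pos (other w))) (λ _ → d ∸ 1 + 2)
         (λ _ _ _ _ → edge-sym K _ _ _ _)
         (λ w w' w≢w' → cover-neighbours≤ K (other w) (other w') (λ e → w≢w' (other-injective w w' e)))
         (λ w w' e → other-injective w w' (pos-injective (toℕ-injective e)))
         budget)
    where
    budget : ∀ w → countF (banNeighbours (deleteFibre (edge K) u) (banNeighbours (edge K) noBans u x) v′ y w)
                   + countF (λ w' → adj G (other w') (other w) ∧ (toℕ (pos (other w')) <ᵇ toℕ (pos (other w))))
                   ≤ d ∸ 1 + 2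
    budget w = ≤-trans (+-mono-≤ fromXY fromEarlier) (≤-reflexive (+-comm 2 (d ∸ 1)))
      where
      open ≤-Reasoning
      fromXY : countF (banNeighbours (deleteFibre (edge K) u) (banNeighbours (edge K) noBans u x) v′ y w) ≤ 2
      fromXY = begin
        countF (λ a → edge K u x (other w) a ∨ edge K (punchIn u v′) y (other w) a)
          ≤⟨ countF-∨ (edge K u x (other w)) (edge K (punchIn u v′) y (other w)) ⟩
        countF (edge K u x (other w)) + countF (edge K (punchIn u v′) y (other w))
          ≤⟨ +-mono-≤ (≤-trans (cover-neighbours≤ K u (other w) (λ e → other≢u w (≡-sym e)) x) (𝟙≤1 _))
                      (≤-trans (cover-neighbours≤ K (punchIn u v′) (other w) (λ e → other≢v w (trans (≡-sym e) v′-is-v)) y) (𝟙≤1 _)) ⟩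
        2 ∎
      earlier = λ a → adj G a (other w) ∧ (pos a <ᶠ pos (other w))
      fromEarlier : countF (earlier ∘ other) ≤ d ∸ 1
      fromEarlier = ≤-trans (countF-punch-≤ (earlier ∘ punchIn u) v′)
                            (≤-trans (countF-punch-≤ earlier u) (earlier≤ (other w)))

PDP-addEdge-bound : ∀ {n} (G : Graph n) {m} (K : Cover G m) {u v : Fin n} → u ≢ v → adj G u v ≡ true →
  {x y : Fin m} → (∀ j → edge K u x v j ≡ false) → (∀ j → edge K v y u j ≡ false) →
  ∀ d → HasColOrdering G d → (k : ℕ) → (∀ (K₀ : Cover G m) → k ≤ PDP K₀) →
  k + (m ∸ (d ∸ 1 + 2)) ^ (n ∸ 2) ≤ PDP K
PDP-addEdge-bound {zero}        G K {()}
PDP-addEdge-bound {suc zero}    G K {zero} {zero} u≢v = ⊥-elim (u≢v refl)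
PDP-addEdge-bound {suc (suc n)} G {m} K u≢v uv {x} {y} x-free y-free d col k k≤ = begin
  k + (m ∸ (d ∸ 1 + 2)) ^ n              ≤⟨ +-mono-≤ (k≤ K+xy) (colouringsWith-bound d col) ⟩
  PDP K+xy + colouringsWith (edge K) x y ≡⟨ ≡-sym PDP-addEdge ⟩
  PDP K                                  ∎
  where
  open AddEdge G K u≢v uv x-free y-free using (K+xy)
  open AddEdgeCount G K u≢v uv x-free y-free
  open ≤-Reasoning

module JoinCover {n} (G : Graph n) {m} (𝓗 : Cover (joinK1 G) (suc m)) (perfect : PerfectMatchings 𝓗) where

  E = edge 𝓗

  -- the unique neighbour of (w , t) in L(u); it is the vertex of L(u) deleted in H^(t)
  nbr : Fin (suc m) → Fin n → Fin (suc m)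
  nbr t u = proj₁ (perfect zero (suc u) t refl)

  nbr-edge : ∀ t u → E zero t (suc u) (nbr t u) ≡ true
  nbr-edge t u = proj₂ (perfect zero (suc u) t refl)

  nbr-unique : ∀ t u i → E zero t (suc u) i ≡ true → i ≡ nbr t u
  nbr-unique t u i e = matching 𝓗 zero (suc u) t i (nbr t u) refl e (nbr-edge t u)

  -- H^(t) = H - N_H[(w , t)], each L^(t)(u) renumbered by Fin m
  H^ : Fin (suc m) → Cover G m
  H^ t = record
    { edge           = λ u i v j → E (suc u) (punchIn (nbr t u) i) (suc v) (punchIn (nbr t v) j)
    ; edge-sym       = λ u i v j → edge-sym 𝓗 _ _ _ _
    ; edge-loopless  = λ u i → edge-loopless 𝓗 _ _
    ; fibre-complete = λ u i j i≢j → fibre-complete 𝓗 (suc u) _ _ (λ e → i≢j (punchIn-injective _ _ _ e))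
    ; edge-adj       = λ u i v j u≢v e → edge-adj 𝓗 (suc u) _ (suc v) _ (λ e' → u≢v (Fin-suc-injective e')) e
    ; matching       = λ u v i j j' uv e e' → punchIn-injective (nbr t v) j j' (matching 𝓗 (suc u) (suc v) _ _ _ uv e e')
    }

  -- colouring w first: P_DP(M, H) = Σ_t P_DP(G, H^(t))
  PDP-join : PDP 𝓗 ≡ sumF (λ t → PDP (H^ t))
  PDP-join = trans (PDP≡colourings 𝓗) (sumF-cong λ t →
    trans (colourings-deleteBanned n m (deleteFibre E zero) (banNeighbours E (λ _ _ → false) zero t) (nbr t) (nbr-edge t))
      (trans (colourings-cong n m (λ _ _ _ _ _ → refl)
                (λ u i → ≢true⇒false (λ e → punchInᵢ≢i (nbr t u) i (nbr-unique t u _ e))))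
        (≡-sym (PDP≡colourings (H^ t)))))

  Aligned : Fin (suc m) → Fin n → Fin n → Bool
  Aligned t u v = E (suc u) (nbr t u) (suc v) (nbr t v)

  crossFrom : Fin (suc m) → Fin n → Fin n → Fin (suc m) → Fin (suc m) → Bool
  crossFrom t u v i j = not (removed 𝓗 t u i) ∧ not (removed 𝓗 t v j) ∧ E (suc u) i (suc v) j

  -- if t is aligned on uv ∈ E(G), the perfect matching L(u)–L(v) loses exactly the
  -- edge between the deleted vertices, leaving m cross-edges
  cross-aligned : ∀ t u v → adj G u v ≡ true → Aligned t u v ≡ true →
    sumF (λ i → countF (crossFrom t u v i)) ≡ m
  cross-aligned t u v uv aligned =
    trans (sumF-punch (λ i → countF (crossFrom t u v i)) (nbr t u))
      (trans (cong₂ _+_ deleted (sumF-cong remaining)) (trans (sumF-const m 1) (*-identityʳ m)))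
    where
    deleted : countF (crossFrom t u v (nbr t u)) ≡ 0
    deleted = countF-false _ (λ j → cong (λ b → not b ∧ not (removed 𝓗 t v j) ∧ E (suc u) (nbr t u) (suc v) j) (nbr-edge t u))
    remaining : ∀ i′ → countF (crossFrom t u v (punchIn (nbr t u) i′)) ≡ 1
    remaining i′ = countF-unique (crossFrom t u v i) j₀ (∧-intro (not-true i-kept) (∧-intro (not-true j₀-kept) e₀)) unique
      where
      i = punchIn (nbr t u) i′
      j₀ = proj₁ (perfect (suc u) (suc v) i uv)
      e₀ = proj₂ (perfect (suc u) (suc v) i uv)
      i-kept : removed 𝓗 t u i ≡ false
      i-kept = ≢true⇒false (λ e → punchInᵢ≢i (nbr t u) i′ (nbr-unique t u i e))
      -- the deleted vertex of L(v) is matched to the deleted vertex of L(u), not to i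
      j₀-kept : removed 𝓗 t v j₀ ≡ false
      j₀-kept = ≢true⇒false (λ e → punchInᵢ≢i (nbr t u) i′
        (matching 𝓗 (suc v) (suc u) (nbr t v) i (nbr t u) (trans (Graph.sym G v u) uv)
          (trans (edge-sym 𝓗 (suc v) (nbr t v) (suc u) i) (subst (λ z → E (suc u) i (suc v) z ≡ true) (nbr-unique t v j₀ e) e₀))
          (trans (edge-sym 𝓗 (suc v) (nbr t v) (suc u) (nbr t u)) aligned)))
      unique : ∀ j → crossFrom t u v i j ≡ true → j ≡ j₀
      unique j h = matching 𝓗 (suc u) (suc v) i j j₀ uv (∧-conicalʳ (not (removed 𝓗 t v j)) _ (∧-conicalʳ (not (removed 𝓗 t u i)) _ h)) e₀

  cross-nonadjacent : ∀ t u v → u ≢ v → adj G u v ≡ false → ∀ i → countF (crossFrom t u v i) ≡ 0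
  cross-nonadjacent t u v u≢v ¬uv i = countF-false _ (λ j → ∧-false {not (removed 𝓗 t u i)} (inj₂ (∧-false {not (removed 𝓗 t v j)} (inj₂
    (≢true⇒false (λ e → true≢false (trans (≡-sym (edge-adj 𝓗 (suc u) i (suc v) j (λ e′ → u≢v (Fin-suc-injective e′)) e)) ¬uv)))))))

  aligned⇒level : ∀ t → (∀ u v → adj G u v ≡ true → Aligned t u v ≡ true) → isLevel 𝓗 t ≡ true
  aligned⇒level t aligned = ≡⇒≡ᵇ′ (≡-sym (begin
    numEdges G * m
      ≡⟨ sumF-*ʳ (λ u → countF (λ v → (u <ᶠ v) ∧ adj G u v)) m ⟩
    sumF (λ u → countF (λ v → (u <ᶠ v) ∧ adj G u v) * m)
      ≡⟨ sumF-cong (λ u → trans (cong (_* m) (countF-sum (λ v → (u <ᶠ v) ∧ adj G u v)))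
                                (sumF-*ʳ (λ v → 𝟙 ((u <ᶠ v) ∧ adj G u v)) m)) ⟩
    sumF (λ u → sumF (λ v → 𝟙 ((u <ᶠ v) ∧ adj G u v) * m))
      ≡⟨ sumF-cong (λ u → sumF-cong (λ v → ≡-sym (pair u v))) ⟩
    crossEdges 𝓗 t ∎))
    where
    open ≡-Reasoning
    <ᶠ⇒≢ : ∀ u v → (u <ᶠ v) ≡ true → u ≢ v
    <ᶠ⇒≢ u v h refl = <-irrefl refl (<ᵇ⇒< (toℕ u) (toℕ u) (subst T (≡-sym h) _))
    pair : ∀ u v → sumF (λ i → countF (λ j → (u <ᶠ v) ∧ crossFrom t u v i j)) ≡ 𝟙 ((u <ᶠ v) ∧ adj G u v) * m
    pair u v with u <ᶠ v in u<v | adj G u v in uv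
    ... | false | _     = trans (sumF-cong {suc m} (λ i → countF-false {suc m} _ (λ _ → refl))) (sumF-zero (suc m))
    ... | true  | true  = trans (cross-aligned t u v uv (aligned u v uv)) (≡-sym (+-identityʳ m))
    ... | true  | false = trans (sumF-cong (cross-nonadjacent t u v (<ᶠ⇒≢ u v u<v) uv)) (sumF-zero (suc m))

  -- if t is not aligned on uv ∈ E(G), the vertex of L^(t)(u) matched to the deleted
  -- vertex of L(v) has no neighbour in L^(t)(v)
  free-vertex : ∀ t u v → adj G u v ≡ true → Aligned t u v ≡ false →
    Σ (Fin m) λ x → ∀ j → edge (H^ t) u x v j ≡ false
  free-vertex t u v uv misaligned = punchOut nbr≢x₀ , λ j → ≢true⇒false (λ e →
      punchInᵢ≢i (nbr t v) j (matching 𝓗 (suc u) (suc v) _ _ _ uv e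
        (subst (λ z → E (suc u) z (suc v) (nbr t v) ≡ true) (≡-sym (punchIn-punchOut nbr≢x₀))
          (trans (edge-sym 𝓗 (suc u) x₀ (suc v) (nbr t v)) x₀-edge))))
    where
    x₀ = proj₁ (perfect (suc v) (suc u) (nbr t v) (trans (Graph.sym G v u) uv))
    x₀-edge = proj₂ (perfect (suc v) (suc u) (nbr t v) (trans (Graph.sym G v u) uv))
    nbr≢x₀ : nbr t u ≢ x₀
    nbr≢x₀ eq = true≢false (trans (≡-sym (trans (edge-sym 𝓗 (suc u) (nbr t u) (suc v) (nbr t v))
                  (subst (λ z → E (suc v) (nbr t v) (suc u) z ≡ true) (≡-sym eq) x₀-edge))) misaligned)

  -- a non-level vertex (w , t) leaves room for an extra edge in H^(t)
  nonLevel-bound : ∀ t → isLevel 𝓗 t ≡ false → ∀ d → HasColOrdering G d →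
    (k : ℕ) → (∀ (K₀ : Cover G m) → k ≤ PDP K₀) → k + (m ∸ (d ∸ 1 + 2)) ^ (n ∸ 2) ≤ PDP (H^ t)
  nonLevel-bound t nonLevel d col k k≤ with search₂ (λ u v → adj G u v ∧ not (Aligned t u v))
  ... | inj₂ none = ⊥-elim (true≢false (trans (≡-sym (aligned⇒level t aligned)) nonLevel))
    where
    aligned : ∀ u v → adj G u v ≡ true → Aligned t u v ≡ true
    aligned u v uv = not-injective (subst (λ b → b ∧ not (Aligned t u v) ≡ false) uv (none u v))
  ... | inj₁ (u , v , found) =
    PDP-addEdge-bound G (H^ t) u≢v uv (proj₂ (free-vertex t u v uv misaligned))
      (proj₂ (free-vertex t v u vu (trans (edge-sym 𝓗 (suc v) (nbr t v) (suc u) (nbr t u)) misaligned)))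
      d col k k≤
    where
    uv : adj G u v ≡ true
    uv = ∧-conicalˡ _ _ found
    vu : adj G v u ≡ true
    vu = trans (Graph.sym G v u) uv
    misaligned : Aligned t u v ≡ false
    misaligned = not-false (∧-conicalʳ (adj G u v) _ found)
    u≢v : u ≢ v
    u≢v refl = true≢false (trans (≡-sym uv) (loopless G u))

  PDP-join-bound : ∀ d → HasColOrdering G d → (k : ℕ) → (∀ (K₀ : Cover G m) → k ≤ PDP K₀) →
    suc m * k + numNonLevel 𝓗 * (m ∸ (d ∸ 1 + 2)) ^ (n ∸ 2) ≤ PDP 𝓗
  PDP-join-bound d col k k≤ = begin
    suc m * k + numNonLevel 𝓗 * X
      ≡⟨ cong₂ _+_ (≡-sym (sumF-const (suc m) k))
           (trans (cong (_* X) (countF-sum (λ t → not (isLevel 𝓗 t)))) (sumF-*ʳ (λ t → 𝟙 (not (isLevel 𝓗 t))) X)) ⟩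
    sumF {suc m} (λ _ → k) + sumF (λ t → 𝟙 (not (isLevel 𝓗 t)) * X)
      ≡⟨ ≡-sym (sumF-+ (λ _ → k) (λ t → 𝟙 (not (isLevel 𝓗 t)) * X)) ⟩
    sumF (λ t → k + 𝟙 (not (isLevel 𝓗 t)) * X)
      ≤⟨ sumF-mono perVertex ⟩
    sumF (λ t → PDP (H^ t))
      ≡⟨ ≡-sym PDP-join ⟩
    PDP 𝓗 ∎
    where
    open ≤-Reasoning
    X = (m ∸ (d ∸ 1 + 2)) ^ (n ∸ 2)
    perVertex : ∀ t → k + 𝟙 (not (isLevel 𝓗 t)) * X ≤ PDP (H^ t)
    perVertex t with isLevel 𝓗 t in level
    ... | true  = subst (_≤ PDP (H^ t)) (≡-sym (+-identityʳ k)) (k≤ (H^ t))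
    ... | false = subst (λ z → k + z ≤ PDP (H^ t)) (≡-sym (+-identityʳ X)) (nonLevel-bound t level d col k k≤)

lemma5p2 : (n : ℕ) (G : Graph n) → Connected G →
    (d : ℕ) → ColoringNumber G d → 3 ≤ d →
    (m : ℕ) → d + 3 ≤ m →
    (𝓗 : Cover (joinK1 G) m) → PerfectMatchings 𝓗 →
    (s : ℕ) → s ≤ numNonLevel 𝓗 →
    (k : ℕ) → IsPDPmin G (m ∸ 1) k →
    m * k + s * (m ∸ d ∸ 2) ^ (n ∸ 2) ≤ PDP 𝓗
lemma5p2 n G _ zero     _ ()
lemma5p2 n G _ (suc d′) _ _ zero ()
lemma5p2 n G _ (suc d′) (col , _) _ (suc m′) _ 𝓗 perfect s s≤ k (_ , k≤) = begin
  suc m′ * k + s * (m′ ∸ d′ ∸ 2) ^ (n ∸ 2)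
    ≡⟨ cong (λ z → suc m′ * k + s * z ^ (n ∸ 2)) (∸-+-assoc m′ d′ 2) ⟩
  suc m′ * k + s * X
    ≤⟨ +-monoʳ-≤ (suc m′ * k) (*-monoˡ-≤ X s≤) ⟩
  suc m′ * k + numNonLevel 𝓗 * X
    ≤⟨ JoinCover.PDP-join-bound G 𝓗 perfect (suc d′) col k k≤ ⟩
  PDP 𝓗 ∎
  where
  open ≤-Reasoning
  X = (m′ ∸ (d′ + 2)) ^ (n ∸ 2)
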